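{- Let $\mathcal{T}$ be a theory that includes intuitionistic predicate calculus. Let ${\sf P}$ be a problem $\forall x\,(p_1(x)\to\exists y\,p_2(x,y))$ and ${\sf Q}$ a problem $\forall u\,(q_1(u)\to\exists v\,q_2(u,v))$. Suppose $\mathcal{T}$ proves ${\sf Q}$ with one typical use of ${\sf P}$. Then \[\mathcal{T}\vdash \forall u\,\exists x\,\forall y\,\exists v\,\bigl(q_1(u)\to(p_1(x)\land(p_2(x,y)\to q_2(u,v)))\bigr).\]
   Context: A problem is a formula of the form $\forall x\,(p_1(x)\to\exists y\,p_2(x,y))$: $x$ with $p_1(x)$ is an instance, and $y$ with $p_2(x,y)$ is a solution for $x$. A theory $\mathcal{T}$ proves ${\sf Q}:\forall u\,(q_1(u)\to\exists v\,q_2(u,v))$ with one typical use of ${\sf P}:\forall x\,(p_1(x)\to\exists y\,p_2(x,y))$ if both of the following hold: (i) for a variable $u$ there is a term $x_u$ such that, using only axioms of $\mathcal{T}$ and the assumption $q_1(u)$, and with no applications of generalization to $u$ or to any variable appearing free in $x_u$, there is a deduction of $p_1(x_u)$; (ii) for a previously unused constant symbol $y_0$, there is a term $v_{x_u,y_0}$ such that, using only axioms of $\mathcal{T}$ and the assumption $p_2(x_u,y_0)$, and with no applications of generalization to $u$ or to any variable appearing free in $x_u$ or $v_{x_u,y_0}$, there is a deduction of $q_2(u,v_{x_u,y_0})$. -}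

module Defs where

open import Data.Nat using (ℕ; suc)
open import Data.Fin using (Fin; zero; suc; #_)
open import Data.Vec using (Vec; []; _∷_)
open import Data.Vec.Relation.Unary.Any using (Any)
open import Data.Sum using (_⊎_; inj₁; inj₂)
open import Data.Product using (Σ; ∃; _×_; _,_)
open import Data.Empty using (⊥)
open import Relation.Nullary using (¬_)
open import Relation.Binary.PropositionalEquality using (_≡_; refl)

-- First-order languages (no equality symbol needed: pure predicate calculus)

record Language : Set₁ where
  field
    Func : ℕ → Set   -- function symbols of each arity (constants = arity 0)
    Rel  : ℕ → Set
open Language public

_+const : Language → Language
Func (L +const) n = Func L n ⊎ (n ≡ 0)
Rel  (L +const) n = Rel L n

-- Locally nameless syntax: free variables are named by ℕ,
-- bound variables are de Bruijn indices in Fin k (k binders in scope).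

data Term (L : Language) (k : ℕ) : Set where
  var  : ℕ → Term L k
  bvar : Fin k → Term L k
  fn   : ∀ {n} → Func L n → Vec (Term L k) n → Term L k

infixr 6 _∧'_ _∨'_
infixr 5 _⇒'_

data Formula (L : Language) (k : ℕ) : Set where
  rel  : ∀ {n} → Rel L n → Vec (Term L k) n → Formula L k
  ⊥'   : Formula L k
  _∧'_ : Formula L k → Formula L k → Formula L k
  _∨'_ : Formula L k → Formula L k → Formula L k
  _⇒'_ : Formula L k → Formula L k → Formula L k
  ∀'   : Formula L (suc k) → Formula L k
  ∃'   : Formula L (suc k) → Formula L k

mutual
  substT : ∀ {L k m} → (Fin k → Term L m) → Term L k → Term L m
  substT σ (var x)   = var x
  substT σ (bvar i)  = σ i
  substT σ (fn f ts) = fn f (substTs σ ts)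

  substTs : ∀ {L k m n} → (Fin k → Term L m) → Vec (Term L k) n → Vec (Term L m) n
  substTs σ []       = []
  substTs σ (t ∷ ts) = substT σ t ∷ substTs σ ts

weakenT : ∀ {L m} → Term L m → Term L (suc m)
weakenT = substT (λ i → bvar (suc i))

lift : ∀ {L k m} → (Fin k → Term L m) → Fin (suc k) → Term L (suc m)
lift σ zero    = bvar zero
lift σ (suc i) = weakenT (σ i)

substF : ∀ {L k m} → (Fin k → Term L m) → Formula L k → Formula L m
substF σ (rel r ts) = rel r (substTs σ ts)
substF σ ⊥'         = ⊥'
substF σ (A ∧' B)   = substF σ A ∧' substF σ B
substF σ (A ∨' B)   = substF σ A ∨' substF σ B
substF σ (A ⇒' B)   = substF σ A ⇒' substF σ B
substF σ (∀' A)     = ∀' (substF (lift σ) A)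
substF σ (∃' A)     = ∃' (substF (lift σ) A)

inst : ∀ {L k} → Formula L (suc k) → Term L k → Formula L k
inst {L} {k} A t = substF σ A
  where
  σ : Fin (suc k) → Term L k
  σ zero    = t
  σ (suc i) = bvar i

_⟨_⟩ : ∀ {L k} → Formula L 1 → Term L k → Formula L k
A ⟨ t ⟩ = substF (λ _ → t) A

-- A formula p(x,y) : Formula L 2 (x = index 0, y = index 1);  p(s,t), written A ⟨ s ∣ t ⟩
_⟨_∣_⟩ : ∀ {L k} → Formula L 2 → Term L k → Term L k → Formula L k
_⟨_∣_⟩ {L} {k} A s t = substF σ A
  where
  σ : Fin 2 → Term L k
  σ zero    = s
  σ (suc _) = t

data _∈T_ {L : Language} {k : ℕ} (w : ℕ) : Term L k → Set where
  here : w ∈T var w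
  infn : ∀ {n} {f : Func L n} {ts : Vec (Term L k) n} →
         Any (w ∈T_) ts → w ∈T fn f ts

data _∈F_ {L : Language} (w : ℕ) : ∀ {k} → Formula L k → Set where
  inrel : ∀ {k n} {r : Rel L n} {ts : Vec (Term L k) n} →
          Any (w ∈T_) ts → w ∈F rel r ts
  ∧ˡ : ∀ {k} {A B : Formula L k} → w ∈F A → w ∈F (A ∧' B)
  ∧ʳ : ∀ {k} {A B : Formula L k} → w ∈F B → w ∈F (A ∧' B)
  ∨ˡ : ∀ {k} {A B : Formula L k} → w ∈F A → w ∈F (A ∨' B)
  ∨ʳ : ∀ {k} {A B : Formula L k} → w ∈F B → w ∈F (A ∨' B)
  ⇒ˡ : ∀ {k} {A B : Formula L k} → w ∈F A → w ∈F (A ⇒' B)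
  ⇒ʳ : ∀ {k} {A B : Formula L k} → w ∈F B → w ∈F (A ⇒' B)
  in∀ : ∀ {k} {A : Formula L (suc k)} → w ∈F A → w ∈F ∀' A
  in∃ : ∀ {k} {A : Formula L (suc k)} → w ∈F A → w ∈F ∃' A

-- no free (named) variables; only the displayed bound variables remain
Closed : ∀ {L k} → Formula L k → Set
Closed A = ∀ w → ¬ (w ∈F A)

mutual
  embT : ∀ {L k} → Term L k → Term (L +const) k
  embT (var x)   = var x
  embT (bvar i)  = bvar i
  embT (fn f ts) = fn (inj₁ f) (embTs ts)

  embTs : ∀ {L k n} → Vec (Term L k) n → Vec (Term (L +const) k) n
  embTs []       = []
  embTs (t ∷ ts) = embT t ∷ embTs ts

embF : ∀ {L k} → Formula L k → Formula (L +const) k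
embF (rel r ts) = rel r (embTs ts)
embF ⊥'         = ⊥'
embF (A ∧' B)   = embF A ∧' embF B
embF (A ∨' B)   = embF A ∨' embF B
embF (A ⇒' B)   = embF A ⇒' embF B
embF (∀' A)     = ∀' (embF A)
embF (∃' A)     = ∃' (embF A)

newConst : ∀ {L k} → Term (L +const) k
newConst = fn (inj₂ refl) []

-- Deductions in intuitionistic predicate calculus (Kleene's Hilbert system,
-- with ⊥ primitive and ¬A := A ⇒ ⊥) from the nonlogical axioms Ax and the
-- assumptions Hyp, where generalization (the ∀- and ∃-rules) is never
-- applied to a variable in Forb.

data Deriv {L : Language} (Ax Hyp : Formula L 0 → Set) (Forb : ℕ → Set)
           : Formula L 0 → Set where
  ax  : ∀ {A} → Ax A → Deriv Ax Hyp Forb A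
  hyp : ∀ {A} → Hyp A → Deriv Ax Hyp Forb A
  mp  : ∀ {A B} → Deriv Ax Hyp Forb A → Deriv Ax Hyp Forb (A ⇒' B) →
        Deriv Ax Hyp Forb B
  K   : ∀ {A B} → Deriv Ax Hyp Forb (A ⇒' (B ⇒' A))
  S   : ∀ {A B C} →
        Deriv Ax Hyp Forb ((A ⇒' B) ⇒' ((A ⇒' (B ⇒' C)) ⇒' (A ⇒' C)))
  ∧I  : ∀ {A B} → Deriv Ax Hyp Forb (A ⇒' (B ⇒' (A ∧' B)))
  ∧E₁ : ∀ {A B} → Deriv Ax Hyp Forb ((A ∧' B) ⇒' A)
  ∧E₂ : ∀ {A B} → Deriv Ax Hyp Forb ((A ∧' B) ⇒' B)
  ∨I₁ : ∀ {A B} → Deriv Ax Hyp Forb (A ⇒' (A ∨' B))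
  ∨I₂ : ∀ {A B} → Deriv Ax Hyp Forb (B ⇒' (A ∨' B))
  ∨E  : ∀ {A B C} →
        Deriv Ax Hyp Forb ((A ⇒' C) ⇒' ((B ⇒' C) ⇒' ((A ∨' B) ⇒' C)))
  ⊥E  : ∀ {A} → Deriv Ax Hyp Forb (⊥' ⇒' A)
  ∀E  : ∀ {A : Formula L 1} {t : Term L 0} → Deriv Ax Hyp Forb (∀' A ⇒' inst A t)
  ∃I  : ∀ {A : Formula L 1} {t : Term L 0} → Deriv Ax Hyp Forb (inst A t ⇒' ∃' A)
  ∀R  : ∀ {C : Formula L 0} {A : Formula L 1} (x : ℕ) →
        ¬ Forb x → ¬ (x ∈F C) → ¬ (x ∈F A) →
        Deriv Ax Hyp Forb (C ⇒' inst A (var x)) → Deriv Ax Hyp Forb (C ⇒' ∀' A)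
  ∃R  : ∀ {C : Formula L 0} {A : Formula L 1} (x : ℕ) →
        ¬ Forb x → ¬ (x ∈F C) → ¬ (x ∈F A) →
        Deriv Ax Hyp Forb (inst A (var x) ⇒' C) → Deriv Ax Hyp Forb (∃' A ⇒' C)

_⊢_ : ∀ {L} → (Formula L 0 → Set) → Formula L 0 → Set
Ax ⊢ A = Deriv Ax (λ _ → ⊥) (λ _ → ⊥) A

-- Problems  ∀x (p₁(x) → ∃y p₂(x,y)):  p₁ has only x free, p₂ only x,y.

record Problem (L : Language) : Set where
  constructor problem
  field
    pre     : Formula L 1
    post    : Formula L 2   -- p₂(x,y), x = index 0, y = index 1
    closed₁ : Closed pre
    closed₂ : Closed post
open Problem public

OneTypicalUse : ∀ {L} → (Formula L 0 → Set) → Problem L → Problem L → Set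
OneTypicalUse {L} Ax P Q =
  Σ ℕ λ u → Σ (Term L 0) λ xu →
    Deriv Ax (_≡ pre Q ⟨ var u ⟩) (λ w → w ≡ u ⊎ w ∈T xu) (pre P ⟨ xu ⟩)
    ×
    -- (ii)  with the previously unused constant y₀ = newConst
    Σ (Term (L +const) 0) λ v →
      Deriv {L +const} (λ B → ∃ λ A → Ax A × B ≡ embF A)
            (_≡ embF (post P) ⟨ embT xu ∣ newConst ⟩)
            (λ w → w ≡ u ⊎ w ∈T xu ⊎ w ∈T v)
            (embF (post Q) ⟨ var u ∣ v ⟩)

-- ∀u ∃x ∀y ∃v (q₁(u) → (p₁(x) ∧ (p₂(x,y) → q₂(u,v))))
-- bound indices in the matrix: u = 3, x = 2, y = 1, v = 0
uniformization : ∀ {L} → Problem L → Problem L → Formula L 0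
uniformization P Q =
  ∀' (∃' (∀' (∃'
    (pre Q ⟨ bvar (# 3) ⟩ ⇒'
      (pre P ⟨ bvar (# 2) ⟩ ∧'
        (post P ⟨ bvar (# 2) ∣ bvar (# 1) ⟩ ⇒' post Q ⟨ bvar (# 3) ∣ bvar (# 0) ⟩))))))

-- Replace the fresh constant y₀ of deduction (ii) by a variable y chosen larger than every variable
-- mentioned so far; the deduction theorem then turns (i) and (ii) into ⊢ q₁(u) → p₁(x_u) and
-- ⊢ p₂(x_u, y) → q₂(u, v) with v := v_{x_u,y}.  Both are unrestricted deductions, so the prefix
-- ∀u ∃x ∀y ∃v is introduced with the witnesses x := x_u and v, generalizing over y and u.
module Submission where

open import Defs
open import Data.Nat using (ℕ; suc; _⊔_; _≤_; _<_; s≤s)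
open import Data.Nat.Properties using (m≤m⊔n; m≤n⊔m; ≤-trans; ≤-refl; <⇒≢; <-irrefl)
open import Data.Fin using (Fin; zero; suc; #_)
open import Data.Vec using (Vec; []; _∷_)
open import Data.Vec.Functional using () renaming (_∷_ to _∷ᶠ_)
open import Data.Vec.Relation.Unary.Any using (Any; here; there)
open import Data.Sum using (_⊎_; inj₁; inj₂; map₁; [_,_]′)
open import Data.Product using (∃; _×_; _,_)
open import Data.Empty using (⊥-elim)
open import Function using (_∘_)
open import Relation.Nullary using (¬_)
open import Relation.Binary.PropositionalEquality
  using (_≡_; refl; sym; trans; cong; cong₂; subst)

private
  variable
    L : Language
    k m p : ℕ

mutual
  substT-cong : {σ τ : Fin k → Term L m} → (∀ i → σ i ≡ τ i) → ∀ t → substT σ t ≡ substT τ t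
  substT-cong e (var x)   = refl
  substT-cong e (bvar i)  = e i
  substT-cong e (fn f ts) = cong (fn f) (substTs-cong e ts)

  substTs-cong : ∀ {n} {σ τ : Fin k → Term L m} → (∀ i → σ i ≡ τ i) →
                 (ts : Vec (Term L k) n) → substTs σ ts ≡ substTs τ ts
  substTs-cong e []       = refl
  substTs-cong e (t ∷ ts) = cong₂ _∷_ (substT-cong e t) (substTs-cong e ts)

mutual
  substT-∘ : (σ : Fin m → Term L p) (τ : Fin k → Term L m) (t : Term L k) →
             substT σ (substT τ t) ≡ substT (substT σ ∘ τ) t
  substT-∘ σ τ (var x)   = refl
  substT-∘ σ τ (bvar i)  = refl
  substT-∘ σ τ (fn f ts) = cong (fn f) (substTs-∘ σ τ ts)

  substTs-∘ : ∀ {n} (σ : Fin m → Term L p) (τ : Fin k → Term L m) (ts : Vec (Term L k) n) →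
              substTs σ (substTs τ ts) ≡ substTs (substT σ ∘ τ) ts
  substTs-∘ σ τ []       = refl
  substTs-∘ σ τ (t ∷ ts) = cong₂ _∷_ (substT-∘ σ τ t) (substTs-∘ σ τ ts)

mutual
  substT-id : (t : Term L k) → substT bvar t ≡ t
  substT-id (var x)   = refl
  substT-id (bvar i)  = refl
  substT-id (fn f ts) = cong (fn f) (substTs-id ts)

  substTs-id : ∀ {n} (ts : Vec (Term L k) n) → substTs bvar ts ≡ ts
  substTs-id []       = refl
  substTs-id (t ∷ ts) = cong₂ _∷_ (substT-id t) (substTs-id ts)

lift-cong : {σ τ : Fin k → Term L m} → (∀ i → σ i ≡ τ i) → ∀ i → lift σ i ≡ lift τ i
lift-cong e zero    = refl
lift-cong e (suc i) = cong weakenT (e i)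

substF-cong : {σ τ : Fin k → Term L m} → (∀ i → σ i ≡ τ i) → ∀ A → substF σ A ≡ substF τ A
substF-cong e (rel r ts) = cong (rel r) (substTs-cong e ts)
substF-cong e ⊥'         = refl
substF-cong e (A ∧' B)   = cong₂ _∧'_ (substF-cong e A) (substF-cong e B)
substF-cong e (A ∨' B)   = cong₂ _∨'_ (substF-cong e A) (substF-cong e B)
substF-cong e (A ⇒' B)   = cong₂ _⇒'_ (substF-cong e A) (substF-cong e B)
substF-cong e (∀' A)     = cong ∀' (substF-cong (lift-cong e) A)
substF-cong e (∃' A)     = cong ∃' (substF-cong (lift-cong e) A)

lift-∘ : (σ : Fin m → Term L p) (τ : Fin k → Term L m) →
         ∀ i → substT (lift σ) (lift τ i) ≡ lift (substT σ ∘ τ) i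
lift-∘ σ τ zero    = refl
lift-∘ σ τ (suc i) = trans (substT-∘ (lift σ) (bvar ∘ suc) (τ i))
                           (sym (substT-∘ (bvar ∘ suc) σ (τ i)))

substF-∘ : (σ : Fin m → Term L p) (τ : Fin k → Term L m) (A : Formula L k) →
           substF σ (substF τ A) ≡ substF (substT σ ∘ τ) A
substF-∘ σ τ (rel r ts) = cong (rel r) (substTs-∘ σ τ ts)
substF-∘ σ τ ⊥'         = refl
substF-∘ σ τ (A ∧' B)   = cong₂ _∧'_ (substF-∘ σ τ A) (substF-∘ σ τ B)
substF-∘ σ τ (A ∨' B)   = cong₂ _∨'_ (substF-∘ σ τ A) (substF-∘ σ τ B)
substF-∘ σ τ (A ⇒' B)   = cong₂ _⇒'_ (substF-∘ σ τ A) (substF-∘ σ τ B)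
substF-∘ σ τ (∀' A)     = cong ∀' (trans (substF-∘ (lift σ) (lift τ) A) (substF-cong (lift-∘ σ τ) A))
substF-∘ σ τ (∃' A)     = cong ∃' (trans (substF-∘ (lift σ) (lift τ) A) (substF-cong (lift-∘ σ τ) A))

substF-⟨⟩ : (σ : Fin k → Term L m) (A : Formula L 1) (s : Term L k) →
            substF σ (A ⟨ s ⟩) ≡ A ⟨ substT σ s ⟩
substF-⟨⟩ σ A s = trans (substF-∘ σ _ A) (substF-cong (λ { zero → refl }) A)

substF-⟨∣⟩ : (σ : Fin k → Term L m) (A : Formula L 2) (s t : Term L k) →
             substF σ (A ⟨ s ∣ t ⟩) ≡ A ⟨ substT σ s ∣ substT σ t ⟩
substF-⟨∣⟩ σ A s t = trans (substF-∘ σ _ A) (substF-cong (λ { zero → refl ; (suc zero) → refl }) A)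

inst-lift : (ρ : Fin k → Term L m) (B : Formula L (suc k)) (t : Term L m) →
            inst (substF (lift ρ) B) t ≡ substF (t ∷ᶠ ρ) B
inst-lift ρ B t = trans (substF-∘ _ (lift ρ) B) (substF-cong instance-lift B)
  where
  instance-lift : ∀ i → substT _ (lift ρ i) ≡ (t ∷ᶠ ρ) i
  instance-lift zero    = refl
  instance-lift (suc i) = trans (substT-∘ _ (bvar ∘ suc) (ρ i)) (substT-id (ρ i))

inst-∷ᶠ : (B : Formula L 1) (t : Term L 0) → inst B t ≡ substF (t ∷ᶠ λ ()) B
inst-∷ᶠ B t = substF-cong (λ { zero → refl }) B

mutual
  ∈-substT : ∀ {w} (σ : Fin k → Term L m) t → w ∈T substT σ t → w ∈T t ⊎ ∃ λ i → w ∈T σ i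
  ∈-substT σ (var x)   here     = inj₁ here
  ∈-substT σ (bvar i)  w∈      = inj₂ (i , w∈)
  ∈-substT σ (fn f ts) (infn a) = map₁ infn (∈-substTs σ ts a)

  ∈-substTs : ∀ {n w} (σ : Fin k → Term L m) (ts : Vec (Term L k) n) →
              Any (w ∈T_) (substTs σ ts) → Any (w ∈T_) ts ⊎ ∃ λ i → w ∈T σ i
  ∈-substTs σ (t ∷ ts) (here w∈)  = map₁ here (∈-substT σ t w∈)
  ∈-substTs σ (t ∷ ts) (there w∈) = map₁ there (∈-substTs σ ts w∈)

∈-lift : ∀ {w} (σ : Fin k → Term L m) i → w ∈T lift σ i → ∃ λ j → w ∈T σ j
∈-lift σ (suc i) w∈ = [ (λ w∈σi → i , w∈σi) , (λ { (_ , ()) }) ]′ (∈-substT (bvar ∘ suc) (σ i) w∈)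

∈-substF : ∀ {w} (σ : Fin k → Term L m) A → w ∈F substF σ A → w ∈F A ⊎ ∃ λ i → w ∈T σ i
∈-substF σ (rel r ts) (inrel a) = map₁ inrel (∈-substTs σ ts a)
∈-substF σ (A ∧' B) (∧ˡ w∈) = map₁ ∧ˡ (∈-substF σ A w∈)
∈-substF σ (A ∧' B) (∧ʳ w∈) = map₁ ∧ʳ (∈-substF σ B w∈)
∈-substF σ (A ∨' B) (∨ˡ w∈) = map₁ ∨ˡ (∈-substF σ A w∈)
∈-substF σ (A ∨' B) (∨ʳ w∈) = map₁ ∨ʳ (∈-substF σ B w∈)
∈-substF σ (A ⇒' B) (⇒ˡ w∈) = map₁ ⇒ˡ (∈-substF σ A w∈)
∈-substF σ (A ⇒' B) (⇒ʳ w∈) = map₁ ⇒ʳ (∈-substF σ B w∈)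
∈-substF σ (∀' A) (in∀ w∈) =
  [ inj₁ ∘ in∀ , (λ { (i , w∈σi) → inj₂ (∈-lift σ i w∈σi) }) ]′ (∈-substF (lift σ) A w∈)
∈-substF σ (∃' A) (in∃ w∈) =
  [ inj₁ ∘ in∃ , (λ { (i , w∈σi) → inj₂ (∈-lift σ i w∈σi) }) ]′ (∈-substF (lift σ) A w∈)

∉-substF : ∀ {w} {σ : Fin k → Term L m} (A : Formula L k) → Closed A →
           (∀ i → ¬ w ∈T σ i) → ¬ w ∈F substF σ A
∉-substF {w = w} {σ} A closed w∉σ w∈ = [ closed w , (λ { (i , w∈σi) → w∉σ i w∈σi }) ]′ (∈-substF σ A w∈)

∈-var : ∀ {w x} → w ∈T var {L} {k} x → w ≡ x
∈-var here = refl

mutual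
  maxVarT : Term L k → ℕ
  maxVarT (var x)   = x
  maxVarT (bvar i)  = 0
  maxVarT (fn f ts) = maxVarTs ts

  maxVarTs : ∀ {n} → Vec (Term L k) n → ℕ
  maxVarTs []       = 0
  maxVarTs (t ∷ ts) = maxVarT t ⊔ maxVarTs ts

mutual
  ∈⇒≤maxVarT : ∀ {w} {t : Term L k} → w ∈T t → w ≤ maxVarT t
  ∈⇒≤maxVarT here     = ≤-refl
  ∈⇒≤maxVarT (infn a) = ∈⇒≤maxVarTs a

  ∈⇒≤maxVarTs : ∀ {n w} {ts : Vec (Term L k) n} → Any (w ∈T_) ts → w ≤ maxVarTs ts
  ∈⇒≤maxVarTs {ts = t ∷ ts} (here w∈)  = ≤-trans (∈⇒≤maxVarT w∈) (m≤m⊔n (maxVarT t) (maxVarTs ts))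
  ∈⇒≤maxVarTs {ts = t ∷ ts} (there w∈) = ≤-trans (∈⇒≤maxVarTs w∈) (m≤n⊔m (maxVarT t) (maxVarTs ts))

module _ {Ax Hyp : Formula L 0 → Set} {Forb : ℕ → Set} where
  private
    ⊢_ : Formula L 0 → Set
    ⊢_ = Deriv Ax Hyp Forb

  ⇒-refl : ∀ {A} → ⊢ (A ⇒' A)
  ⇒-refl {A} = mp (K {A = A} {B = A ⇒' A}) (mp (K {A = A} {B = A}) S)

  ⇒-const : ∀ {A B} → ⊢ B → ⊢ (A ⇒' B)
  ⇒-const d = mp d K

  ⇒-mp : ∀ {X Y Z} → ⊢ (X ⇒' Y) → ⊢ (X ⇒' (Y ⇒' Z)) → ⊢ (X ⇒' Z)
  ⇒-mp d e = mp e (mp d S)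

  ⇒-trans : ∀ {X Y Z} → ⊢ (X ⇒' Y) → ⊢ (Y ⇒' Z) → ⊢ (X ⇒' Z)
  ⇒-trans d e = ⇒-mp d (⇒-const e)

  ⇒-∧ : ∀ {X Y Z} → ⊢ (X ⇒' Y) → ⊢ (X ⇒' Z) → ⊢ (X ⇒' (Y ∧' Z))
  ⇒-∧ d e = ⇒-mp e (⇒-trans d ∧I)

  ⇒-uncurry : ∀ {X Y Z} → ⊢ (X ⇒' (Y ⇒' Z)) → ⊢ ((X ∧' Y) ⇒' Z)
  ⇒-uncurry d = ⇒-mp ∧E₂ (⇒-trans ∧E₁ d)

  ⇒-curry : ∀ {X Y Z} → ⊢ ((X ∧' Y) ⇒' Z) → ⊢ (X ⇒' (Y ⇒' Z))
  ⇒-curry d = ⇒-trans ∧I (⇒-mp (⇒-const (⇒-const d)) S)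

  ⇒-swap : ∀ {X Y Z} → ⊢ (X ⇒' (Y ⇒' Z)) → ⊢ (Y ⇒' (X ⇒' Z))
  ⇒-swap d = ⇒-curry (⇒-trans (⇒-∧ ∧E₂ ∧E₁) (⇒-uncurry d))

deduction : ∀ {Ax Hyp Forb} {H A : Formula L 0} →
            (∀ B → Hyp B → B ≡ H) → (∀ w → w ∈F H → Forb w) →
            Deriv Ax Hyp Forb A → Ax ⊢ (H ⇒' A)
deduction hyp≡H fv⊆Forb (ax a) = ⇒-const (ax a)
deduction {H = H} hyp≡H fv⊆Forb (hyp h) = subst (λ B → _ ⊢ (H ⇒' B)) (sym (hyp≡H _ h)) ⇒-refl
deduction hyp≡H fv⊆Forb (mp d e) = ⇒-mp (deduction hyp≡H fv⊆Forb d) (deduction hyp≡H fv⊆Forb e)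
deduction hyp≡H fv⊆Forb K   = ⇒-const K
deduction hyp≡H fv⊆Forb S   = ⇒-const S
deduction hyp≡H fv⊆Forb ∧I  = ⇒-const ∧I
deduction hyp≡H fv⊆Forb ∧E₁ = ⇒-const ∧E₁
deduction hyp≡H fv⊆Forb ∧E₂ = ⇒-const ∧E₂
deduction hyp≡H fv⊆Forb ∨I₁ = ⇒-const ∨I₁
deduction hyp≡H fv⊆Forb ∨I₂ = ⇒-const ∨I₂
deduction hyp≡H fv⊆Forb ∨E  = ⇒-const ∨E
deduction hyp≡H fv⊆Forb ⊥E  = ⇒-const ⊥E
deduction hyp≡H fv⊆Forb ∀E  = ⇒-const ∀E
deduction hyp≡H fv⊆Forb ∃I  = ⇒-const ∃I
deduction hyp≡H fv⊆Forb (∀R x x∉Forb x∉C x∉A d) =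
  ⇒-curry (∀R x (λ ()) x∉H∧C x∉A (⇒-uncurry (deduction hyp≡H fv⊆Forb d)))
  where
  x∉H∧C : ¬ x ∈F (_ ∧' _)
  x∉H∧C (∧ˡ x∈H) = x∉Forb (fv⊆Forb x x∈H)
  x∉H∧C (∧ʳ x∈C) = x∉C x∈C
deduction hyp≡H fv⊆Forb (∃R x x∉Forb x∉C x∉A d) =
  ⇒-swap (∃R x (λ ()) x∉H⇒C x∉A (⇒-swap (deduction hyp≡H fv⊆Forb d)))
  where
  x∉H⇒C : ¬ x ∈F (_ ⇒' _)
  x∉H⇒C (⇒ˡ x∈H) = x∉Forb (fv⊆Forb x x∈H)
  x∉H⇒C (⇒ʳ x∈C) = x∉C x∈C

-- Kleene's ∀-rule only generalizes the consequent of an implication; ⊥ → ⊥ is a closed antecedent.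
∀-intro : ∀ {Ax} {B : Formula L 1} x → ¬ x ∈F ∀' B → Ax ⊢ inst B (var x) → Ax ⊢ ∀' B
∀-intro x x∉∀B d = mp ⇒-refl (∀R x (λ ()) x∉⊤ (x∉∀B ∘ in∀) (⇒-const {A = ⊥' ⇒' ⊥'} d))
  where
  x∉⊤ : ¬ x ∈F (⊥' ⇒' ⊥')
  x∉⊤ (⇒ˡ ())
  x∉⊤ (⇒ʳ ())

∃-intro : ∀ {Ax} {B : Formula L 1} t → Ax ⊢ inst B t → Ax ⊢ ∃' B
∃-intro t d = mp d ∃I

∀-intro-∷ᶠ : ∀ {Ax} {ρ : Fin k → Term L 0} {B : Formula L (suc k)} x →
             ¬ x ∈F substF ρ (∀' B) → Ax ⊢ substF (var x ∷ᶠ ρ) B → Ax ⊢ substF ρ (∀' B)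
∀-intro-∷ᶠ {ρ = ρ} {B} x x∉ d = ∀-intro x x∉ (subst (_ ⊢_) (sym (inst-lift ρ B (var x))) d)

∃-intro-∷ᶠ : ∀ {Ax} {ρ : Fin k → Term L 0} {B : Formula L (suc k)} t →
             Ax ⊢ substF (t ∷ᶠ ρ) B → Ax ⊢ substF ρ (∃' B)
∃-intro-∷ᶠ {ρ = ρ} {B} t d = ∃-intro t (subst (_ ⊢_) (sym (inst-lift ρ B t)) d)

module ConstToVar {L : Language} (y : ℕ) where

  mutual
    constToVarT : Term (L +const) k → Term L k
    constToVarT (var x)             = var x
    constToVarT (bvar i)            = bvar i
    constToVarT (fn (inj₁ f) ts)    = fn f (constToVarTs ts)
    constToVarT (fn (inj₂ refl) []) = var y

    constToVarTs : ∀ {n} → Vec (Term (L +const) k) n → Vec (Term L k) n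
    constToVarTs []       = []
    constToVarTs (t ∷ ts) = constToVarT t ∷ constToVarTs ts

  constToVarF : Formula (L +const) k → Formula L k
  constToVarF (rel r ts) = rel r (constToVarTs ts)
  constToVarF ⊥'         = ⊥'
  constToVarF (A ∧' B)   = constToVarF A ∧' constToVarF B
  constToVarF (A ∨' B)   = constToVarF A ∨' constToVarF B
  constToVarF (A ⇒' B)   = constToVarF A ⇒' constToVarF B
  constToVarF (∀' A)     = ∀' (constToVarF A)
  constToVarF (∃' A)     = ∃' (constToVarF A)

  mutual
    constToVarT-substT : (σ : Fin k → Term (L +const) m) (t : Term (L +const) k) →
                         constToVarT (substT σ t) ≡ substT (constToVarT ∘ σ) (constToVarT t)
    constToVarT-substT σ (var x)             = refl
    constToVarT-substT σ (bvar i)            = refl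
    constToVarT-substT σ (fn (inj₁ f) ts)    = cong (fn f) (constToVarTs-substTs σ ts)
    constToVarT-substT σ (fn (inj₂ refl) []) = refl

    constToVarTs-substTs : ∀ {n} (σ : Fin k → Term (L +const) m) (ts : Vec (Term (L +const) k) n) →
                           constToVarTs (substTs σ ts) ≡ substTs (constToVarT ∘ σ) (constToVarTs ts)
    constToVarTs-substTs σ []       = refl
    constToVarTs-substTs σ (t ∷ ts) = cong₂ _∷_ (constToVarT-substT σ t) (constToVarTs-substTs σ ts)

  constToVarT-lift : (σ : Fin k → Term (L +const) m) →
                     ∀ i → constToVarT (lift σ i) ≡ lift (constToVarT ∘ σ) i
  constToVarT-lift σ zero    = refl
  constToVarT-lift σ (suc i) = constToVarT-substT (bvar ∘ suc) (σ i)

  constToVarF-substF : (σ : Fin k → Term (L +const) m) (A : Formula (L +const) k) →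
                       constToVarF (substF σ A) ≡ substF (constToVarT ∘ σ) (constToVarF A)
  constToVarF-substF σ (rel r ts) = cong (rel r) (constToVarTs-substTs σ ts)
  constToVarF-substF σ ⊥'         = refl
  constToVarF-substF σ (A ∧' B)   = cong₂ _∧'_ (constToVarF-substF σ A) (constToVarF-substF σ B)
  constToVarF-substF σ (A ∨' B)   = cong₂ _∨'_ (constToVarF-substF σ A) (constToVarF-substF σ B)
  constToVarF-substF σ (A ⇒' B)   = cong₂ _⇒'_ (constToVarF-substF σ A) (constToVarF-substF σ B)
  constToVarF-substF σ (∀' A)     =
    cong ∀' (trans (constToVarF-substF (lift σ) A) (substF-cong (constToVarT-lift σ) (constToVarF A)))
  constToVarF-substF σ (∃' A)     =
    cong ∃' (trans (constToVarF-substF (lift σ) A) (substF-cong (constToVarT-lift σ) (constToVarF A)))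

  constToVarF-inst : (A : Formula (L +const) 1) (t : Term (L +const) 0) →
                     constToVarF (inst A t) ≡ inst (constToVarF A) (constToVarT t)
  constToVarF-inst A t = trans (constToVarF-substF _ A) (substF-cong (λ { zero → refl }) (constToVarF A))

  mutual
    constToVarT-embT : (t : Term L k) → constToVarT (embT t) ≡ t
    constToVarT-embT (var x)   = refl
    constToVarT-embT (bvar i)  = refl
    constToVarT-embT (fn f ts) = cong (fn f) (constToVarTs-embTs ts)

    constToVarTs-embTs : ∀ {n} (ts : Vec (Term L k) n) → constToVarTs (embTs ts) ≡ ts
    constToVarTs-embTs []       = refl
    constToVarTs-embTs (t ∷ ts) = cong₂ _∷_ (constToVarT-embT t) (constToVarTs-embTs ts)

  constToVarF-embF : (A : Formula L k) → constToVarF (embF A) ≡ A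
  constToVarF-embF (rel r ts) = cong (rel r) (constToVarTs-embTs ts)
  constToVarF-embF ⊥'         = refl
  constToVarF-embF (A ∧' B)   = cong₂ _∧'_ (constToVarF-embF A) (constToVarF-embF B)
  constToVarF-embF (A ∨' B)   = cong₂ _∨'_ (constToVarF-embF A) (constToVarF-embF B)
  constToVarF-embF (A ⇒' B)   = cong₂ _⇒'_ (constToVarF-embF A) (constToVarF-embF B)
  constToVarF-embF (∀' A)     = cong ∀' (constToVarF-embF A)
  constToVarF-embF (∃' A)     = cong ∃' (constToVarF-embF A)

  constToVarF-embF-⟨∣⟩ : (A : Formula L 2) (s t : Term (L +const) 0) →
                         constToVarF (embF A ⟨ s ∣ t ⟩) ≡ A ⟨ constToVarT s ∣ constToVarT t ⟩
  constToVarF-embF-⟨∣⟩ A s t =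
    trans (constToVarF-substF _ (embF A))
          (trans (cong (substF _) (constToVarF-embF A))
                 (substF-cong (λ { zero → refl ; (suc zero) → refl }) A))

  mutual
    ∈-constToVarT : ∀ {w} (t : Term (L +const) k) → w ∈T constToVarT t → w ∈T t ⊎ w ≡ y
    ∈-constToVarT (var x)             here     = inj₁ here
    ∈-constToVarT (fn (inj₁ f) ts)    (infn a) = map₁ infn (∈-constToVarTs ts a)
    ∈-constToVarT (fn (inj₂ refl) []) here     = inj₂ refl

    ∈-constToVarTs : ∀ {n w} (ts : Vec (Term (L +const) k) n) →
                     Any (w ∈T_) (constToVarTs ts) → Any (w ∈T_) ts ⊎ w ≡ y
    ∈-constToVarTs (t ∷ ts) (here w∈)  = map₁ here (∈-constToVarT t w∈)
    ∈-constToVarTs (t ∷ ts) (there w∈) = map₁ there (∈-constToVarTs ts w∈)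

  ∈-constToVarF : ∀ {w} (A : Formula (L +const) k) → w ∈F constToVarF A → w ∈F A ⊎ w ≡ y
  ∈-constToVarF (rel r ts) (inrel a) = map₁ inrel (∈-constToVarTs ts a)
  ∈-constToVarF (A ∧' B) (∧ˡ w∈) = map₁ ∧ˡ (∈-constToVarF A w∈)
  ∈-constToVarF (A ∧' B) (∧ʳ w∈) = map₁ ∧ʳ (∈-constToVarF B w∈)
  ∈-constToVarF (A ∨' B) (∨ˡ w∈) = map₁ ∨ˡ (∈-constToVarF A w∈)
  ∈-constToVarF (A ∨' B) (∨ʳ w∈) = map₁ ∨ʳ (∈-constToVarF B w∈)
  ∈-constToVarF (A ⇒' B) (⇒ˡ w∈) = map₁ ⇒ˡ (∈-constToVarF A w∈)
  ∈-constToVarF (A ⇒' B) (⇒ʳ w∈) = map₁ ⇒ʳ (∈-constToVarF B w∈)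
  ∈-constToVarF (∀' A)   (in∀ w∈) = map₁ in∀ (∈-constToVarF A w∈)
  ∈-constToVarF (∃' A)   (in∃ w∈) = map₁ in∃ (∈-constToVarF A w∈)

  ∉-constToVarF : ∀ {x} (A : Formula (L +const) k) → ¬ x ≡ y → ¬ x ∈F A → ¬ x ∈F constToVarF A
  ∉-constToVarF A x≢y x∉A x∈ = [ x∉A , x≢y ]′ (∈-constToVarF A x∈)

maxGenVar : ∀ {Ax Hyp Forb} {A : Formula L 0} → Deriv Ax Hyp Forb A → ℕ
maxGenVar (mp d e)         = maxGenVar d ⊔ maxGenVar e
maxGenVar (∀R x _ _ _ d)   = x ⊔ maxGenVar d
maxGenVar (∃R x _ _ _ d)   = x ⊔ maxGenVar d
maxGenVar _                = 0

constToVar-Deriv :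
  ∀ {Ax : Formula L 0 → Set} {Hyp : Formula (L +const) 0 → Set} {Forb : ℕ → Set} {H A} (y : ℕ) →
  (∀ B → Hyp B → ConstToVar.constToVarF y B ≡ H) →
  (d : Deriv (λ B → ∃ λ A → Ax A × B ≡ embF A) Hyp Forb A) → maxGenVar d < y →
  Deriv Ax (_≡ H) (λ w → Forb w ⊎ w ≡ y) (ConstToVar.constToVarF y A)
constToVar-Deriv {Ax = Ax} {Hyp} {Forb} {H} y hyp≡H = go
  where
  open ConstToVar y

  ⊔<ˡ : ∀ {a b} → a ⊔ b < y → a < y
  ⊔<ˡ {a} {b} lt = ≤-trans (s≤s (m≤m⊔n a b)) lt

  ⊔<ʳ : ∀ {a b} → a ⊔ b < y → b < y
  ⊔<ʳ {a} {b} lt = ≤-trans (s≤s (m≤n⊔m a b)) lt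

  ∉Forb : ∀ {x} → ¬ Forb x → x < y → ¬ (Forb x ⊎ x ≡ y)
  ∉Forb x∉Forb x<y = [ x∉Forb , <⇒≢ x<y ]′

  go : ∀ {A} (d : Deriv (λ B → ∃ λ A → Ax A × B ≡ embF A) Hyp Forb A) → maxGenVar d < y →
       Deriv Ax (_≡ H) (λ w → Forb w ⊎ w ≡ y) (constToVarF A)
  go (ax (A , a , refl)) lt = subst (Deriv _ _ _) (sym (constToVarF-embF A)) (ax a)
  go (hyp h)   lt = hyp (hyp≡H _ h)
  go (mp d e)  lt = mp (go d (⊔<ˡ lt)) (go e (⊔<ʳ lt))
  go K   lt = K
  go S   lt = S
  go ∧I  lt = ∧I
  go ∧E₁ lt = ∧E₁
  go ∧E₂ lt = ∧E₂
  go ∨I₁ lt = ∨I₁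
  go ∨I₂ lt = ∨I₂
  go ∨E  lt = ∨E
  go ⊥E  lt = ⊥E
  go (∀E {A} {t}) lt = subst (λ B → Deriv _ _ _ (∀' (constToVarF A) ⇒' B)) (sym (constToVarF-inst A t)) ∀E
  go (∃I {A} {t}) lt = subst (λ B → Deriv _ _ _ (B ⇒' ∃' (constToVarF A))) (sym (constToVarF-inst A t)) ∃I
  go (∀R {C} {A} x x∉Forb x∉C x∉A d) lt =
    ∀R x (∉Forb x∉Forb x<y) (∉-constToVarF C x≢y x∉C) (∉-constToVarF A x≢y x∉A)
       (subst (λ B → Deriv _ _ _ (constToVarF C ⇒' B)) (constToVarF-inst A (var x)) (go d (⊔<ʳ lt)))
    where
    x<y : x < y
    x<y = ⊔<ˡ lt
    x≢y : ¬ x ≡ y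
    x≢y = <⇒≢ x<y
  go (∃R {C} {A} x x∉Forb x∉C x∉A d) lt =
    ∃R x (∉Forb x∉Forb x<y) (∉-constToVarF C x≢y x∉C) (∉-constToVarF A x≢y x∉A)
       (subst (λ B → Deriv _ _ _ (B ⇒' constToVarF C)) (constToVarF-inst A (var x)) (go d (⊔<ʳ lt)))
    where
    x<y : x < y
    x<y = ⊔<ˡ lt
    x≢y : ¬ x ≡ y
    x≢y = <⇒≢ x<y

discharge-pre : ∀ {Ax} {A : Formula L 1} {B : Formula L 0} {u : ℕ} {t : Term L 0} → Closed A →
                Deriv Ax (_≡ A ⟨ var u ⟩) (λ w → w ≡ u ⊎ w ∈T t) B → Ax ⊢ (A ⟨ var u ⟩ ⇒' B)
discharge-pre {A = A} {u = u} {t} closed = deduction (λ _ B≡ → B≡) fv⊆u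
  where
  fv⊆u : ∀ w → w ∈F (A ⟨ var u ⟩) → w ≡ u ⊎ w ∈T t
  fv⊆u w w∈ = [ ⊥-elim ∘ closed w , (λ { (zero , here) → inj₁ refl }) ]′
                (∈-substF _ A w∈)

discharge-post :
  ∀ {Ax} {A B : Formula L 2} {s : Term L 0} {u : ℕ} {v : Term (L +const) 0} (y : ℕ) → Closed A →
  (d : Deriv (λ C → ∃ λ A′ → Ax A′ × C ≡ embF A′) (_≡ embF A ⟨ embT s ∣ newConst ⟩)
             (λ w → w ≡ u ⊎ w ∈T s ⊎ w ∈T v) (embF B ⟨ var u ∣ v ⟩)) →
  maxGenVar d < y → Ax ⊢ (A ⟨ s ∣ var y ⟩ ⇒' B ⟨ var u ∣ ConstToVar.constToVarT y v ⟩)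
discharge-post {Ax = Ax} {A} {B} {s} {u} {v} y closed d gen<y =
  subst (λ C → Ax ⊢ (A ⟨ s ∣ var y ⟩ ⇒' C)) (constToVarF-embF-⟨∣⟩ B (var u) v)
    (deduction (λ _ C≡ → C≡) fv⊆ (constToVar-Deriv y hyp≡ d gen<y))
  where
  open ConstToVar y

  hyp≡ : ∀ C → C ≡ embF A ⟨ embT s ∣ newConst ⟩ → constToVarF C ≡ A ⟨ s ∣ var y ⟩
  hyp≡ C refl = trans (constToVarF-embF-⟨∣⟩ A (embT s) newConst)
                      (cong (λ t → A ⟨ t ∣ var y ⟩) (constToVarT-embT s))

  fv⊆ : ∀ w → w ∈F (A ⟨ s ∣ var y ⟩) → (w ≡ u ⊎ w ∈T s ⊎ w ∈T v) ⊎ w ≡ y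
  fv⊆ w w∈ = [ ⊥-elim ∘ closed w
             , (λ { (zero , w∈s) → inj₁ (inj₂ (inj₁ w∈s)) ; (suc zero , here) → inj₂ refl }) ]′
             (∈-substF _ A w∈)

-- uniformization P Q is ∀' (∃' (∀' (∃' (matrix P Q)))) by definition.
matrix : Problem L → Problem L → Formula L 4
matrix P Q = pre Q ⟨ bvar (# 3) ⟩ ⇒'
               (pre P ⟨ bvar (# 2) ⟩ ∧'
                 (post P ⟨ bvar (# 2) ∣ bvar (# 1) ⟩ ⇒' post Q ⟨ bvar (# 3) ∣ bvar (# 0) ⟩))

matrix-closed : (P Q : Problem L) → Closed (matrix P Q)
matrix-closed P Q w (⇒ˡ w∈)           = ∉-substF (pre Q) (closed₁ Q) (λ _ ()) w∈
matrix-closed P Q w (⇒ʳ (∧ˡ w∈))      = ∉-substF (pre P) (closed₁ P) (λ _ ()) w∈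
matrix-closed P Q w (⇒ʳ (∧ʳ (⇒ˡ w∈))) = ∉-substF (post P) (closed₂ P) (λ { zero () ; (suc _) () }) w∈
matrix-closed P Q w (⇒ʳ (∧ʳ (⇒ʳ w∈))) = ∉-substF (post Q) (closed₂ Q) (λ { zero () ; (suc _) () }) w∈

substF-matrix : (P Q : Problem L) (ρ : Fin 4 → Term L m) →
                substF ρ (matrix P Q) ≡
                  (pre Q ⟨ ρ (# 3) ⟩ ⇒'
                    (pre P ⟨ ρ (# 2) ⟩ ∧' (post P ⟨ ρ (# 2) ∣ ρ (# 1) ⟩ ⇒' post Q ⟨ ρ (# 3) ∣ ρ (# 0) ⟩)))
substF-matrix P Q ρ =
  cong₂ _⇒'_ (substF-⟨⟩ ρ (pre Q) _)
    (cong₂ _∧'_ (substF-⟨⟩ ρ (pre P) _)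
      (cong₂ _⇒'_ (substF-⟨∣⟩ ρ (post P) _ _) (substF-⟨∣⟩ ρ (post Q) _ _)))

lemma2p2 : (L : Language) (Ax : Formula L 0 → Set) (P Q : Problem L) →
    OneTypicalUse Ax P Q → Ax ⊢ uniformization P Q
lemma2p2 L Ax P Q (u , xu , d₁ , v , d₂) =
  ∀-intro u (λ { (in∀ (in∃ (in∀ (in∃ u∈)))) → matrix-closed P Q u u∈ })
    (subst (Ax ⊢_) (sym (inst-∷ᶠ _ (var u)))
      (∃-intro-∷ᶠ xu (∀-intro-∷ᶠ y y-fresh (∃-intro-∷ᶠ (constToVarT v)
        (subst (Ax ⊢_) (sym (substF-matrix P Q _))
          (⇒-∧ (discharge-pre (closed₁ Q) d₁)
               (⇒-const (discharge-post y (closed₂ P) d₂ (s≤s (m≤m⊔n _ _))))))))))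
  where
  y : ℕ
  y = suc (maxGenVar d₂ ⊔ (u ⊔ maxVarT xu))
  open ConstToVar y

  y-fresh : ¬ y ∈F substF (xu ∷ᶠ var u ∷ᶠ λ ()) (∀' (∃' (matrix P Q)))
  y-fresh = ∉-substF (∀' (∃' (matrix P Q))) (λ { w (in∀ (in∃ w∈)) → matrix-closed P Q w w∈ })
              (λ { zero y∈xu → <-irrefl refl (xu<y y∈xu) ; (suc zero) y∈u → <⇒≢ u<y (sym (∈-var y∈u)) })
    where
    u<y : u < y
    u<y = s≤s (≤-trans (m≤m⊔n u (maxVarT xu)) (m≤n⊔m (maxGenVar d₂) _))

    xu<y : ∀ {w} → w ∈T xu → w < y
    xu<y w∈ = s≤s (≤-trans (∈⇒≤maxVarT w∈) (≤-trans (m≤n⊔m u (maxVarT xu)) (m≤n⊔m (maxGenVar d₂) _)))
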